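{- Let $\mathcal{E}$ be a well-pointed, locally finite cartesian closed category. Then every $\mathcal{E}$-recognizable language of $\lambda$-terms is $\mathbf{FinSet}$-recognizable: for every simple type $A$, object $e$ of $\mathcal{E}$ and $F\subseteq\mathcal{E}(1,[\![A]\!]_e)$, there exist a finite set $Q$ and $F'\subseteq[\![A]\!]_Q$ such that $\{t\in\mathrm{Tm}(A)\mid[\![t]\!]_e\in F\} = \{t\in\mathrm{Tm}(A)\mid[\![t]\!]_Q\in F'\}$.
   Context: Simple types: $A ::= o \mid A\to B \mid A\times B \mid 1$; $\mathrm{Tm}(A)$ is the set of closed simply typed $\lambda$-terms (with pairs, projections, unit) of type $A$ modulo $\beta\eta$. For a CCC $\mathcal{C}$ (with specified structure) and object $c$: $[\![o]\!]_c=c$, $[\![A\to B]\!]_c=[\![A]\!]_c\Rightarrow[\![B]\!]_c$, $[\![A\times B]\!]_c=[\![A]\!]_c\times[\![B]\!]_c$, $[\![1]\!]_c=1$, and $[\![t]\!]_c\in\mathcal{C}(1,[\![A]\!]_c)$ is the standard interpretation. $\mathbf{FinSet}$ is the CCC of finite sets and functions (its interpretation is the naive set-theoretic one, and a finite set is identified with its set of points). A CCC is well-pointed if every morphism is determined by its action on points $1\to a$ of its domain, and locally finite if all hom-sets are finite. -}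

module Defs where

open import Level using (Level; _⊔_) renaming (suc to lsuc)
open import Data.Nat using (ℕ)
open import Data.Fin using (Fin)
open import Data.List using (List; []; _∷_)
open import Data.Product using (Σ; _,_; proj₁; proj₂) renaming (_×_ to _×ₛ_)
open import Data.Unit using (⊤; tt)
open import Relation.Binary.PropositionalEquality using (_≡_)
open import Function.Bundles using (_↔_)

infixr 7 _⇒_
infixr 8 _×ᵗ_

data Ty : Set where
  o    : Ty
  _⇒_  : Ty → Ty → Ty
  _×ᵗ_ : Ty → Ty → Ty
  𝟙    : Ty

Ctx : Set
Ctx = List Ty

data _∋_ : Ctx → Ty → Set where
  here  : ∀ {Γ A} → (A ∷ Γ) ∋ A
  there : ∀ {Γ A B} → Γ ∋ A → (B ∷ Γ) ∋ A

data Term (Γ : Ctx) : Ty → Set where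
  var  : ∀ {A} → Γ ∋ A → Term Γ A
  lam  : ∀ {A B} → Term (A ∷ Γ) B → Term Γ (A ⇒ B)
  app  : ∀ {A B} → Term Γ (A ⇒ B) → Term Γ A → Term Γ B
  pair : ∀ {A B} → Term Γ A → Term Γ B → Term Γ (A ×ᵗ B)
  fst  : ∀ {A B} → Term Γ (A ×ᵗ B) → Term Γ A
  snd  : ∀ {A B} → Term Γ (A ×ᵗ B) → Term Γ B
  unit : Term Γ 𝟙

Tm : Ty → Set
Tm A = Term [] A

record CCC (o′ ℓ : Level) : Set (lsuc (o′ ⊔ ℓ)) where
  infixr 9 _∘_
  infixr 7 _⇨_
  infixr 8 _×ₒ_
  field
    Obj : Set o′
    Hom : Obj → Obj → Set ℓ
    id  : ∀ {a} → Hom a a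
    _∘_ : ∀ {a b c} → Hom b c → Hom a b → Hom a c
    identityˡ : ∀ {a b} (f : Hom a b) → id ∘ f ≡ f
    identityʳ : ∀ {a b} (f : Hom a b) → f ∘ id ≡ f
    assoc : ∀ {a b c d} (h : Hom c d) (g : Hom b c) (f : Hom a b) →
            (h ∘ g) ∘ f ≡ h ∘ (g ∘ f)
    𝟏 : Obj
    ! : ∀ {a} → Hom a 𝟏
    !-unique : ∀ {a} (f : Hom a 𝟏) → f ≡ !
    _×ₒ_ : Obj → Obj → Obj
    π₁ : ∀ {a b} → Hom (a ×ₒ b) a
    π₂ : ∀ {a b} → Hom (a ×ₒ b) b
    ⟨_,_⟩ : ∀ {c a b} → Hom c a → Hom c b → Hom c (a ×ₒ b)
    π₁-β : ∀ {c a b} (f : Hom c a) (g : Hom c b) → π₁ ∘ ⟨ f , g ⟩ ≡ f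
    π₂-β : ∀ {c a b} (f : Hom c a) (g : Hom c b) → π₂ ∘ ⟨ f , g ⟩ ≡ g
    ⟨⟩-unique : ∀ {c a b} (f : Hom c a) (g : Hom c b) (h : Hom c (a ×ₒ b)) →
                π₁ ∘ h ≡ f → π₂ ∘ h ≡ g → h ≡ ⟨ f , g ⟩
    _⇨_ : Obj → Obj → Obj
    eval : ∀ {b c} → Hom ((b ⇨ c) ×ₒ b) c
    curry : ∀ {a b c} → Hom (a ×ₒ b) c → Hom a (b ⇨ c)
    curry-β : ∀ {a b c} (f : Hom (a ×ₒ b) c) →
              eval ∘ ⟨ curry f ∘ π₁ , π₂ ⟩ ≡ f
    curry-unique : ∀ {a b c} (f : Hom (a ×ₒ b) c) (h : Hom a (b ⇨ c)) →
                   eval ∘ ⟨ h ∘ π₁ , π₂ ⟩ ≡ f → h ≡ curry f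

  WellPointed : Set (o′ ⊔ ℓ)
  WellPointed = ∀ {a b} (f g : Hom a b) →
                (∀ (x : Hom 𝟏 a) → f ∘ x ≡ g ∘ x) → f ≡ g

  LocallyFinite : Set (o′ ⊔ ℓ)
  LocallyFinite = ∀ (a b : Obj) → Σ ℕ λ n → Fin n ↔ Hom a b

  ⟦_⟧ᵀ : Ty → Obj → Obj
  ⟦ o ⟧ᵀ c = c
  ⟦ A ⇒ B ⟧ᵀ c = ⟦ A ⟧ᵀ c ⇨ ⟦ B ⟧ᵀ c
  ⟦ A ×ᵗ B ⟧ᵀ c = ⟦ A ⟧ᵀ c ×ₒ ⟦ B ⟧ᵀ c
  ⟦ 𝟙 ⟧ᵀ c = 𝟏

  ⟦_⟧ᶜ : Ctx → Obj → Obj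
  ⟦ [] ⟧ᶜ c = 𝟏
  ⟦ A ∷ Γ ⟧ᶜ c = ⟦ Γ ⟧ᶜ c ×ₒ ⟦ A ⟧ᵀ c

  ⟦_⟧ᵛ : ∀ {Γ A} → Γ ∋ A → (c : Obj) → Hom (⟦ Γ ⟧ᶜ c) (⟦ A ⟧ᵀ c)
  ⟦ here ⟧ᵛ c = π₂
  ⟦ there x ⟧ᵛ c = ⟦ x ⟧ᵛ c ∘ π₁

  ⟦_⟧ᵗ : ∀ {Γ A} → Term Γ A → (c : Obj) → Hom (⟦ Γ ⟧ᶜ c) (⟦ A ⟧ᵀ c)
  ⟦ var x ⟧ᵗ c = ⟦ x ⟧ᵛ c
  ⟦ lam t ⟧ᵗ c = curry (⟦ t ⟧ᵗ c)
  ⟦ app t u ⟧ᵗ c = eval ∘ ⟨ ⟦ t ⟧ᵗ c , ⟦ u ⟧ᵗ c ⟩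
  ⟦ pair t u ⟧ᵗ c = ⟨ ⟦ t ⟧ᵗ c , ⟦ u ⟧ᵗ c ⟩
  ⟦ fst t ⟧ᵗ c = π₁ ∘ ⟦ t ⟧ᵗ c
  ⟦ snd t ⟧ᵗ c = π₂ ∘ ⟦ t ⟧ᵗ c
  ⟦ unit ⟧ᵗ c = !

  ⟦_⟧_ : ∀ {A} → Tm A → (c : Obj) → Hom 𝟏 (⟦ A ⟧ᵀ c)
  ⟦ t ⟧ c = ⟦ t ⟧ᵗ c

⟦_⟧Fin : Ty → ℕ → Set
⟦ o ⟧Fin n = Fin n
⟦ A ⇒ B ⟧Fin n = ⟦ A ⟧Fin n → ⟦ B ⟧Fin n
⟦ A ×ᵗ B ⟧Fin n = ⟦ A ⟧Fin n ×ₛ ⟦ B ⟧Fin n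
⟦ 𝟙 ⟧Fin n = ⊤

data Env (n : ℕ) : Ctx → Set where
  []  : Env n []
  _∷_ : ∀ {A Γ} → ⟦ A ⟧Fin n → Env n Γ → Env n (A ∷ Γ)

lookupEnv : ∀ {n Γ A} → Env n Γ → Γ ∋ A → ⟦ A ⟧Fin n
lookupEnv (v ∷ ρ) here = v
lookupEnv (v ∷ ρ) (there x) = lookupEnv ρ x

evalFin : ∀ {n Γ A} → Term Γ A → Env n Γ → ⟦ A ⟧Fin n
evalFin (var x) ρ = lookupEnv ρ x
evalFin (lam t) ρ = λ v → evalFin t (v ∷ ρ)
evalFin (app t u) ρ = evalFin t ρ (evalFin u ρ)
evalFin (pair t u) ρ = evalFin t ρ , evalFin u ρ
evalFin (fst t) ρ = proj₁ (evalFin t ρ)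
evalFin (snd t) ρ = proj₂ (evalFin t ρ)
evalFin unit ρ = tt

⟦_⟧Fin[_] : ∀ {A} → Tm A → (n : ℕ) → ⟦ A ⟧Fin n
⟦ t ⟧Fin[ n ] = evalFin t []

-- Take Q to be the set of points 1 → e together with one junk element.  A logical
-- relation between points of ⟦ A ⟧ₑ and elements of ⟦ A ⟧_Q is preserved by the
-- interpretation of every term, and each related element decodes back to its point:
-- at function types, local finiteness makes "g tracks the point f" decidable, so the
-- decoder can search for f, and well-pointedness makes the point found unique.  Hence
-- ⟦ t ⟧_Q decodes to ⟦ t ⟧ₑ, and F′ can be taken to be F after decoding.
module Submission where

open import Defs
open import Level using (Level; Lift; lift)
open import Data.Nat using (ℕ; suc)
open import Data.Fin using (Fin; zero; suc)
import Data.Fin.Properties as Fin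
open import Data.Maybe using (Maybe; just; nothing; maybe′; zipWith)
import Data.Maybe as Maybe
import Data.Maybe.Properties as Maybe
open import Data.Product using (Σ; ∃; _,_; proj₁; proj₂) renaming (_×_ to _×ₛ_)
open import Data.Unit using (⊤; tt)
open import Data.Empty using (⊥; ⊥-elim)
open import Data.List using ([]; _∷_)
open import Relation.Nullary using (Dec; yes; no)
open import Relation.Nullary.Decidable using (map′; via-injection; dec⇒maybe)
open import Relation.Unary using (Pred; Decidable)
open import Relation.Binary.Definitions using (DecidableEquality)
open import Relation.Binary.PropositionalEquality
open import Function.Bundles using (_↔_; _⇔_; Inverse)
open import Function.Properties.Inverse using (↔⇒↣; ↔-sym)
open import Function.Construct.Identity using (⇔-id)

Finite : ∀ {a} → Set a → Set a
Finite X = Σ ℕ λ n → Fin n ↔ X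

module Finite {a} {X : Set a} (finite : Finite X) where
  open Inverse (proj₂ finite)

  _≟_ : DecidableEquality X
  _≟_ = via-injection (↔⇒↣ (↔-sym (proj₂ finite))) Fin._≟_

  any? : ∀ {p} {P : Pred X p} → Decidable P → Dec (∃ P)
  any? {P = P} P? = map′ (λ (k , p) → to k , p)
    (λ (x , p) → from x , subst P (sym (strictlyInverseˡ x)) p)
    (Fin.any? λ k → P? (to k))

  all? : ∀ {p} {P : Pred X p} → Decidable P → Dec (∀ x → P x)
  all? {P = P} P? = map′ (λ ∀P x → subst P (strictlyInverseˡ x) (∀P (from x)))
    (λ ∀P k → ∀P (to k))
    (Fin.all? λ k → P? (to k))

module CCCProperties {o′ ℓ} (𝓒 : CCC o′ ℓ) where
  open CCC 𝓒
  open ≡-Reasoning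

  first : ∀ {a a′ b} → Hom a a′ → Hom (a ×ₒ b) (a′ ×ₒ b)
  first f = ⟨ f ∘ π₁ , π₂ ⟩

  ⟨⟩∘ : ∀ {c d a b} (f : Hom c a) (g : Hom c b) (h : Hom d c) →
        ⟨ f , g ⟩ ∘ h ≡ ⟨ f ∘ h , g ∘ h ⟩
  ⟨⟩∘ f g h = ⟨⟩-unique _ _ _
    (trans (sym (assoc _ _ _)) (cong (_∘ h) (π₁-β f g)))
    (trans (sym (assoc _ _ _)) (cong (_∘ h) (π₂-β f g)))

  ⟨⟩-η : ∀ {c a b} (p : Hom c (a ×ₒ b)) → ⟨ π₁ ∘ p , π₂ ∘ p ⟩ ≡ p
  ⟨⟩-η p = sym (⟨⟩-unique _ _ p refl refl)

  first∘⟨⟩ : ∀ {d a a′ b} (k : Hom a a′) (g : Hom d a) (h : Hom d b) →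
             first k ∘ ⟨ g , h ⟩ ≡ ⟨ k ∘ g , h ⟩
  first∘⟨⟩ k g h = trans (⟨⟩∘ _ _ _)
    (cong₂ ⟨_,_⟩ (trans (assoc _ _ _) (cong (k ∘_) (π₁-β g h))) (π₂-β g h))

  eval-curry : ∀ {a b c d} (f : Hom (a ×ₒ b) c) (g : Hom d a) (h : Hom d b) →
               eval ∘ ⟨ curry f ∘ g , h ⟩ ≡ f ∘ ⟨ g , h ⟩
  eval-curry f g h = begin
    eval ∘ ⟨ curry f ∘ g , h ⟩           ≡⟨ cong (eval ∘_) (first∘⟨⟩ (curry f) g h) ⟨
    eval ∘ (first (curry f) ∘ ⟨ g , h ⟩) ≡⟨ assoc _ _ _ ⟨
    (eval ∘ first (curry f)) ∘ ⟨ g , h ⟩ ≡⟨ cong (_∘ ⟨ g , h ⟩) (curry-β f) ⟩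
    f ∘ ⟨ g , h ⟩                        ∎

  ∘-⟨⟩∘ : ∀ {c d a b e} (k : Hom (a ×ₒ b) e) (f : Hom c a) (g : Hom c b) (h : Hom d c) →
          (k ∘ ⟨ f , g ⟩) ∘ h ≡ k ∘ ⟨ f ∘ h , g ∘ h ⟩
  ∘-⟨⟩∘ k f g h = trans (assoc _ _ _) (cong (k ∘_) (⟨⟩∘ f g h))

  π₁∘⟨⟩∘ : ∀ {c d a b} (f : Hom c a) (g : Hom c b) (h : Hom d c) → π₁ ∘ (⟨ f , g ⟩ ∘ h) ≡ f ∘ h
  π₁∘⟨⟩∘ f g h = trans (sym (assoc _ _ _)) (cong (_∘ h) (π₁-β f g))

  π₂∘⟨⟩∘ : ∀ {c d a b} (f : Hom c a) (g : Hom c b) (h : Hom d c) → π₂ ∘ (⟨ f , g ⟩ ∘ h) ≡ g ∘ h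
  π₂∘⟨⟩∘ f g h = trans (sym (assoc _ _ _)) (cong (_∘ h) (π₂-β f g))

  point∘ : ∀ {a} (x : Hom 𝟏 a) (u : Hom 𝟏 𝟏) → x ∘ u ≡ x
  point∘ x u = trans (cong (x ∘_) (trans (!-unique u) (sym (!-unique id)))) (identityʳ x)

  module _ (wellPointed : WellPointed) where

    point-ext : ∀ {a b} (f f′ : Hom 𝟏 (a ⇨ b)) →
                (∀ x → eval ∘ ⟨ f , x ⟩ ≡ eval ∘ ⟨ f′ , x ⟩) → f ≡ f′
    point-ext {a} {b} f f′ agree = begin
      f                       ≡⟨ curry-unique _ f refl ⟩
      curry (eval ∘ first f)  ≡⟨ cong curry (wellPointed _ _ λ p →
                                   trans (eval-first f p) (trans (agree (π₂ ∘ p)) (sym (eval-first f′ p)))) ⟩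
      curry (eval ∘ first f′) ≡⟨ curry-unique _ f′ refl ⟨
      f′                      ∎
      where
      eval-first : ∀ (g : Hom 𝟏 (a ⇨ b)) (p : Hom 𝟏 (𝟏 ×ₒ a)) →
                   (eval ∘ first g) ∘ p ≡ eval ∘ ⟨ g , π₂ ∘ p ⟩
      eval-first g p = begin
        (eval ∘ first g) ∘ p                     ≡⟨ cong ((eval ∘ first g) ∘_) (⟨⟩-η p) ⟨
        (eval ∘ first g) ∘ ⟨ π₁ ∘ p , π₂ ∘ p ⟩   ≡⟨ assoc _ _ _ ⟩
        eval ∘ (first g ∘ ⟨ π₁ ∘ p , π₂ ∘ p ⟩)   ≡⟨ cong (eval ∘_) (first∘⟨⟩ g _ _) ⟩
        eval ∘ ⟨ g ∘ (π₁ ∘ p) , π₂ ∘ p ⟩         ≡⟨ cong (λ z → eval ∘ ⟨ z , π₂ ∘ p ⟩) (point∘ g _) ⟩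
        eval ∘ ⟨ g , π₂ ∘ p ⟩                    ∎

module Recognition {o′ ℓ} (𝓔 : CCC o′ ℓ) (wellPointed : CCC.WellPointed 𝓔)
                   (locallyFinite : CCC.LocallyFinite 𝓔) (e : CCC.Obj 𝓔) where
  open CCC 𝓔
  open CCCProperties 𝓔

  Point : Ty → Set ℓ
  Point A = Hom 𝟏 (⟦ A ⟧ᵀ e)

  module Points (A : Ty) = Finite (locallyFinite 𝟏 (⟦ A ⟧ᵀ e))
  module BasePoints = Inverse (proj₂ (locallyFinite 𝟏 e))

  -- Q = Fin size; the element zero encodes no point, so every ⟦ A ⟧_Q is inhabited.
  size : ℕ
  size = suc (proj₁ (locallyFinite 𝟏 e))

  Val : Ty → Set
  Val A = ⟦ A ⟧Fin size

  default : ∀ A → Val A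
  default o = zero
  default (A ⇒ B) = λ _ → default B
  default (A ×ᵗ B) = default A , default B
  default 𝟙 = tt

  mutual
    encode : ∀ A → Point A → Val A
    encode o x = suc (BasePoints.from x)
    encode (A ⇒ B) f i = maybe′ (λ x → encode B (eval ∘ ⟨ f , x ⟩)) (default B) (decode A i)
    encode (A ×ᵗ B) p = encode A (π₁ ∘ p) , encode B (π₂ ∘ p)
    encode 𝟙 _ = tt

    Tracks : ∀ A B → Point (A ⇒ B) → (Val A → Val B) → Set ℓ
    Tracks A B f g = ∀ x → decode B (g (encode A x)) ≡ just (eval ∘ ⟨ f , x ⟩)

    tracker? : ∀ A B (g : Val A → Val B) → Dec (∃ λ f → Tracks A B f g)
    tracker? A B g = Points.any? (A ⇒ B) λ f → Points.all? A λ x →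
      Maybe.≡-dec (Points._≟_ B) (decode B (g (encode A x))) (just (eval ∘ ⟨ f , x ⟩))

    decode : ∀ A → Val A → Maybe (Point A)
    decode o zero = nothing
    decode o (suc i) = just (BasePoints.to i)
    decode (A ⇒ B) g = Maybe.map proj₁ (dec⇒maybe (tracker? A B g))
    decode (A ×ᵗ B) (u , v) = zipWith ⟨_,_⟩ (decode A u) (decode B v)
    decode 𝟙 _ = just !

  Related : ∀ A → Point A → Val A → Set ℓ
  Related o x i = Lift ℓ (i ≡ encode o x)
  Related (A ⇒ B) f g = ∀ x i → Related A x i → Related B (eval ∘ ⟨ f , x ⟩) (g i)
  Related (A ×ᵗ B) p (u , v) = Related A (π₁ ∘ p) u ×ₛ Related B (π₂ ∘ p) v
  Related 𝟙 _ _ = Lift ℓ ⊤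

  Related-resp-≡ : ∀ A {x y} v → x ≡ y → Related A x v → Related A y v
  Related-resp-≡ A v refl r = r

  mutual
    encode-related : ∀ A x → Related A x (encode A x)
    encode-related o x = lift refl
    encode-related (A ⇒ B) f x i r rewrite decode-related A x i r = encode-related B _
    encode-related (A ×ᵗ B) p = encode-related A _ , encode-related B _
    encode-related 𝟙 x = lift tt

    decode-related : ∀ A x v → Related A x v → decode A v ≡ just x
    decode-related o x _ (lift refl) = cong just (BasePoints.strictlyInverseˡ x)
    decode-related (A ⇒ B) f g r with tracker? A B g
    ... | yes (f′ , f′-tracks) = cong just (point-ext wellPointed f′ f λ x →
          Maybe.just-injective (trans (sym (f′-tracks x)) (related⇒tracks A B r x)))
    ... | no ∄tracker = ⊥-elim (∄tracker (f , related⇒tracks A B r))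
    decode-related (A ×ᵗ B) p (u , v) (r₁ , r₂)
      rewrite decode-related A _ u r₁ | decode-related B _ v r₂ = cong just (⟨⟩-η p)
    decode-related 𝟙 x _ _ = cong just (sym (!-unique x))

    related⇒tracks : ∀ A B {f g} → Related (A ⇒ B) f g → Tracks A B f g
    related⇒tracks A B r x = decode-related B _ _ (r x _ (encode-related A x))

  RelatedEnv : ∀ Γ → Hom 𝟏 (⟦ Γ ⟧ᶜ e) → Env size Γ → Set ℓ
  RelatedEnv [] _ [] = Lift ℓ ⊤
  RelatedEnv (A ∷ Γ) γ (v ∷ ρ) = RelatedEnv Γ (π₁ ∘ γ) ρ ×ₛ Related A (π₂ ∘ γ) v

  related-var : ∀ {Γ A} (x : Γ ∋ A) {γ ρ} → RelatedEnv Γ γ ρ →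
                Related A (⟦ x ⟧ᵛ e ∘ γ) (lookupEnv ρ x)
  related-var here {ρ = _ ∷ _} (_ , r) = r
  related-var (there x) {ρ = _ ∷ _} (rs , _) =
    Related-resp-≡ _ _ (sym (assoc _ _ _)) (related-var x rs)

  fundamental : ∀ {Γ A} (t : Term Γ A) {γ ρ} → RelatedEnv Γ γ ρ →
                Related A (⟦ t ⟧ᵗ e ∘ γ) (evalFin t ρ)
  fundamental (var x) rs = related-var x rs
  fundamental (lam t) {γ} {ρ} rs x i r =
    Related-resp-≡ _ _ (sym (eval-curry _ γ x))
      (fundamental t ( subst (λ δ → RelatedEnv _ δ ρ) (sym (π₁-β γ x)) rs
                     , Related-resp-≡ _ _ (sym (π₂-β γ x)) r))
  fundamental (app t u) {γ} rs =
    Related-resp-≡ _ _ (sym (∘-⟨⟩∘ eval _ _ γ)) (fundamental t rs _ _ (fundamental u rs))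
  fundamental (pair t u) {γ} rs =
    Related-resp-≡ _ _ (sym (π₁∘⟨⟩∘ _ _ γ)) (fundamental t rs) ,
    Related-resp-≡ _ _ (sym (π₂∘⟨⟩∘ _ _ γ)) (fundamental u rs)
  fundamental (fst t) rs = Related-resp-≡ _ _ (sym (assoc _ _ _)) (proj₁ (fundamental t rs))
  fundamental (snd t) rs = Related-resp-≡ _ _ (sym (assoc _ _ _)) (proj₂ (fundamental t rs))
  fundamental unit rs = lift tt

  decode-⟦⟧Fin : ∀ {A} (t : Tm A) → decode A ⟦ t ⟧Fin[ size ] ≡ just (⟦ t ⟧ e)
  decode-⟦⟧Fin {A} t =
    decode-related A _ _ (Related-resp-≡ A _ (identityʳ _) (fundamental t {id} {[]} (lift tt)))

  recognizer : ∀ {ℓF A} → (Point A → Set ℓF) → Val A → Set ℓF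
  recognizer {ℓF} {A} F v = maybe′ F (Lift ℓF ⊥) (decode A v)

  recognizer-⟦⟧Fin : ∀ {ℓF A} (F : Point A → Set ℓF) (t : Tm A) →
                     F (⟦ t ⟧ e) ⇔ recognizer F ⟦ t ⟧Fin[ size ]
  recognizer-⟦⟧Fin F t rewrite decode-⟦⟧Fin t = ⇔-id _

theorem5p9 : ∀ {o′ ℓ ℓF : Level} (𝓔 : CCC o′ ℓ) →
    CCC.WellPointed 𝓔 → CCC.LocallyFinite 𝓔 →
    ∀ (A : Ty) (e : CCC.Obj 𝓔) (F : CCC.Hom 𝓔 (CCC.𝟏 𝓔) (CCC.⟦_⟧ᵀ 𝓔 A e) → Set ℓF) →
    Σ ℕ λ n → Σ (⟦ A ⟧Fin n → Set ℓF) λ F′ →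
      ∀ (t : Tm A) → F (CCC.⟦_⟧_ 𝓔 t e) ⇔ F′ (⟦ t ⟧Fin[ n ])
theorem5p9 𝓔 wellPointed locallyFinite A e F =
  size , recognizer F , recognizer-⟦⟧Fin F
  where open Recognition 𝓔 wellPointed locallyFinite e
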